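{- Let $\mathcal{G}=(\mathcal{V},\mathit{Act},\mathcal{R})$ be a normed BPA system with no silent variables, and $\alpha,\beta\in\mathcal{V}^*$. Then $\alpha\beta\sim\beta$ if and only if $\alpha\in(\mathrm{Red}(\beta))^*$.
   Context: Branching bisimulation on an LTS (with silent action $\tau$): a symmetric relation $\mathcal{B}$ such that for every $(s,t)\in\mathcal{B}$ and $s\xrightarrow{a}s'$, either $a=\tau$ and $(s',t)\in\mathcal{B}$, or there are $k\ge0$ and $t=t_0\xrightarrow{\tau}\cdots\xrightarrow{\tau}t_k\xrightarrow{a}t'$ with $(s',t')\in\mathcal{B}$ and $(s,t_i)\in\mathcal{B}$ for $1\le i\le k$; $\sim$ is the union of all branching bisimulations. A BPA system $\mathcal{G}=(\mathcal{V},\mathit{Act},\mathcal{R})$: finite variables $\mathcal{V}$, finite actions $\mathit{Act}$ (possibly containing $\tau$), finite rules $A\xrightarrow{a}\alpha$ with $A\in\mathcal{V},\alpha\in\mathcal{V}^*$; its LTS has states $\mathcal{V}^*$ and transitions $A\beta\xrightarrow{a}\alpha\beta$ for each rule and each $\beta$; normed means every variable $A$ has $A\xrightarrow{w}\varepsilon$ for some $w$. A variable $A$ is silent if $A\xrightarrow{w}\alpha$ implies $w\in\{\tau\}^*$. For $\beta\in\mathcal{V}^*$, $\mathrm{Red}(\beta)=\{X\in\mathcal{V}\mid X\beta\sim\beta\}$ (the redundant variables w.r.t. $\beta$). -}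

module Defs where

open import Data.Nat using (ℕ)
open import Data.Fin using (Fin)
open import Data.List using (List; []; _∷_; _++_)
open import Data.List.Membership.Propositional using (_∈_)
open import Data.List.Relation.Unary.All using (All)
open import Data.Product using (Σ; _×_; ∃)
open import Data.Sum using (_⊎_)
open import Relation.Nullary using (¬_)
open import Relation.Binary.PropositionalEquality using (_≡_)

data Action (m : ℕ) : Set where
  τ   : Action m
  vis : Fin m → Action m

record BPA : Set where
  field
    nV    : ℕ
    nA    : ℕ
    rules : List (Fin nV × Action nA × List (Fin nV))

module _ (G : BPA) where
  open BPA G

  Var : Set
  Var = Fin nV

  Act : Set
  Act = Action nA

  State : Set
  State = List Var

  data Step : State → Act → State → Set where
    step : ∀ {A a α} β → (A Data.Product., a Data.Product., α) ∈ rules →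
           Step (A ∷ β) a (α ++ β)

  data Steps : State → List Act → State → Set where
    refl  : ∀ {s} → Steps s [] s
    _◅_   : ∀ {s a s' w s''} → Step s a s' → Steps s' w s'' → Steps s (a ∷ w) s''

  Normed : Set
  Normed = ∀ (A : Var) → ∃ λ w → Steps (A ∷ []) w []

  Silent : Var → Set
  Silent A = ∀ w α → Steps (A ∷ []) w α → All (_≡ τ) w

  NoSilentVars : Set
  NoSilentVars = ∀ (A : Var) → ¬ Silent A

  Rel : Set₁
  Rel = State → State → Set

  -- τ-path t = t₀ --τ--> t₁ ... --τ--> t_k = u with P tᵢ for 1 ≤ i ≤ k.
  data TauPath (P : State → Set) : State → State → Set where
    here  : ∀ {t} → TauPath P t t
    there : ∀ {t u w} → Step t τ u → P u → TauPath P u w → TauPath P t w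

  record IsBranchingBisim (R : Rel) : Set where
    field
      symmetric : ∀ {s t} → R s t → R t s
      transfer  : ∀ {s t a s'} → R s t → Step s a s' →
                  (a ≡ τ × R s' t)
                  ⊎ Σ State λ tk → Σ State λ t' →
                      TauPath (R s) t tk × Step tk a t' × R s' t'

  _∼_ : State → State → Set₁
  s ∼ t = Σ Rel λ R → IsBranchingBisim R × R s t

  Red : State → Var → Set₁
  Red β X = (X ∷ β) ∼ β

-- Backward: branching bisimilarity is transitive and preserved by prefixing,
-- so the redundant variables in front of β can be removed one at a time.
--
-- Forward: let αβ ∼ β and let β run to ε (normedness).  αβ answers with a run
-- to a state bisimilar to ε carrying the same visible actions; without silent
-- variables that state is ε, so the run first empties α by some w₁ and then
-- runs β.  If w₁ contains a visible action, the rest of β's run has fewer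
-- visible actions and we repeat; hence α ⇒τ* ε.  For α = Xα', stuttering along
-- Xα'β ⇒τ* α'β ⇒τ* β gives α'β ∼ β, hence Xβ ∼ Xα'β ∼ β, and we recurse on α'.
--
-- Transitivity and stuttering need care: the composite of two branching
-- bisimulations is only semi-branching (the states passed on a τ-path need not
-- be related), and closing a symmetric semi-branching relation under
-- stuttering yields a branching bisimulation.
module Submission where

open import Data.List using (List; []; _∷_; _++_; map)
open import Data.List.Properties using (++-assoc; map-++)
open import Data.List.Relation.Unary.All using (All; []; _∷_)
open import Data.Nat using (ℕ; zero; suc; _+_; _<_; s≤s; z≤n)
open import Data.Nat.ListAction using (sum)
open import Data.Nat.ListAction.Properties using (sum-++)
open import Data.Nat.Induction using (<-wellFounded)
open import Data.Nat.Properties using (m<n+m; m+n≡0⇒m≡0; m+n≡0⇒n≡0)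
open import Data.Product using (∃; ∃₂; _×_; _,_; proj₁; proj₂; swap)
open import Data.Sum as ⊎ using (_⊎_; inj₁; inj₂)
open import Data.Empty using (⊥-elim)
open import Function.Bundles using (_⇔_; mk⇔)
open import Induction.WellFounded using (Acc; acc)
open import Relation.Binary.Core using (_⇒_)
open import Relation.Binary.Construct.Closure.ReflexiveTransitive
  using (Star; ε; _◅_; _◅◅_; gmap)
open import Relation.Binary.Construct.Composition using (_;_)
open import Relation.Binary.Construct.Union using (_∪_)
open import Relation.Binary.PropositionalEquality
  using (_≡_; refl; sym; trans; cong; cong₂; subst; subst₂)

open import Defs

module BranchingBisimilarity (G : BPA) where
  open IsBranchingBisim

  _⇒τ*_ : Rel G
  _⇒τ*_ = Star (λ s t → Step G s τ t)

  TauPath⇒τ* : ∀ {P t u} → TauPath G P t u → t ⇒τ* u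
  TauPath⇒τ* here              = ε
  TauPath⇒τ* (there st _ path) = st ◅ TauPath⇒τ* path

  TauPath-last : ∀ {P : State G → Set} {t u} → P t → TauPath G P t u → P u
  TauPath-last pt here              = pt
  TauPath-last _  (there _ pu path) = TauPath-last pu path

  TauPath-map : ∀ {P Q : State G → Set} → (∀ {u} → P u → Q u) →
                ∀ {t u} → TauPath G P t u → TauPath G Q t u
  TauPath-map f here              = here
  TauPath-map f (there st pu path) = there st (f pu) (TauPath-map f path)

  TauPath-unsnoc : ∀ {P t u} → TauPath G P t u →
                   t ≡ u ⊎ ∃ λ tk → TauPath G P t tk × Step G tk τ u
  TauPath-unsnoc here = inj₁ refl
  TauPath-unsnoc (there st pu path) with TauPath-unsnoc path
  ... | inj₁ refl               = inj₂ (_ , here , st)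
  ... | inj₂ (tk , path′ , st′) = inj₂ (tk , there st pu path′ , st′)

  -- The answer of t to s ─a→ s′ in a semi-branching bisimulation: unlike in
  -- IsBranchingBisim, only the end points of the τ-path are required related.
  data Answer (R : Rel G) (s : State G) : Act G → State G → State G → Set where
    idle : ∀ {s′ t t₁} → t ⇒τ* t₁ → R s t₁ → R s′ t₁ → Answer R s τ s′ t
    move : ∀ {a s′ t t₁ t′} → t ⇒τ* t₁ → Step G t₁ a t′ → R s t₁ → R s′ t′ →
           Answer R s a s′ t

  SemiTransfer : Rel G → Set
  SemiTransfer R = ∀ {s t a s′} → R s t → Step G s a s′ → Answer R s a s′ t

  Answer-map : ∀ {R R′} → R ⇒ R′ → ∀ {s a s′ t} → Answer R s a s′ t → Answer R′ s a s′ t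
  Answer-map f (idle p r r′)    = idle p (f r) (f r′)
  Answer-map f (move p st r r′) = move p st (f r) (f r′)

  Answer-◅◅ : ∀ {R s a s′ t t₀} → t ⇒τ* t₀ → Answer R s a s′ t₀ → Answer R s a s′ t
  Answer-◅◅ p (idle q r r′)    = idle (p ◅◅ q) r r′
  Answer-◅◅ p (move q st r r′) = move (p ◅◅ q) st r r′

  SemiTransfer-⇒τ* : ∀ {R} → SemiTransfer R → ∀ {s t s₀} → R s t → s ⇒τ* s₀ →
                     ∃ λ t₀ → t ⇒τ* t₀ × R s₀ t₀
  SemiTransfer-⇒τ* tr r ε = _ , ε , r
  SemiTransfer-⇒τ* tr r (st ◅ p) with tr r st
  ... | idle q _ r′ =
    let t₀ , q′ , r₀ = SemiTransfer-⇒τ* tr r′ p in t₀ , q ◅◅ q′ , r₀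
  ... | move q st′ _ r′ =
    let t₀ , q′ , r₀ = SemiTransfer-⇒τ* tr r′ p in t₀ , q ◅◅ st′ ◅ q′ , r₀

  Match : Rel G → Rel G
  Match R u v = ∀ {u₀ a u′} → u ⇒τ* u₀ → Step G u₀ a u′ → Answer R u₀ a u′ v

  SemiTransfer⇒Match : ∀ {R} → SemiTransfer R → ∀ {u v} → R u v → Match R u v
  SemiTransfer⇒Match tr r p st =
    let v₀ , q , r₀ = SemiTransfer-⇒τ* tr r p in Answer-◅◅ q (tr r₀ st)

  -- Closure under between is the stuttering property of branching bisimilarity.
  data Stutter (R : Rel G) : Rel G where
    base    : ∀ {u v} → R u v → Stutter R u v
    inv     : ∀ {u v} → Stutter R v u → Stutter R u v
    between : ∀ {x u y v} → x ⇒τ* u → u ⇒τ* y →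
              Stutter R x v → Stutter R y v → Stutter R u v

  module _ {R : Rel G} (R-sym : ∀ {u v} → R u v → R v u) (R-tr : SemiTransfer R) where

    Stutter-match : ∀ {u v} → Stutter R u v → Match (Stutter R) u v × Match (Stutter R) v u
    Stutter-match (base r) = baseMatch r , baseMatch (R-sym r)
      where
      baseMatch : ∀ {u v} → R u v → Match (Stutter R) u v
      baseMatch r p st = Answer-map base (SemiTransfer⇒Match R-tr r p st)
    Stutter-match (inv q) = swap (Stutter-match q)
    Stutter-match (between x⇒u u⇒y qx qy) =
      (λ p → proj₁ (Stutter-match qx) (x⇒u ◅◅ p)) ,
      (λ p st → Answer-◅◅ u⇒y (proj₂ (Stutter-match qy) p st))

    Stutter-path : ∀ {s x u y} → x ⇒τ* u → u ⇒τ* y →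
                   Stutter R x s → Stutter R y s → TauPath G (Stutter R s) u y
    Stutter-path x⇒u ε        qx qy = here
    Stutter-path x⇒u (st ◅ p) qx qy =
      there st (inv (between (x⇒u ◅◅ st ◅ ε) p qx qy)) (Stutter-path (x⇒u ◅◅ st ◅ ε) p qx qy)

    Stutter-isBranchingBisim : IsBranchingBisim G (Stutter R)
    Stutter-isBranchingBisim .symmetric = inv
    Stutter-isBranchingBisim .transfer q st with proj₁ (Stutter-match q) ε st
    ... | idle p q₁ q₂ with TauPath-unsnoc (Stutter-path ε p (inv q) (inv q₁))
    ...   | inj₁ refl              = inj₁ (refl , q₂)
    ...   | inj₂ (tk , path , st′) = inj₂ (tk , _ , path , st′ , q₂)
    Stutter-isBranchingBisim .transfer q st | move p st′ q₁ q₂ =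
      inj₂ (_ , _ , Stutter-path ε p (inv q) (inv q₁) , st′ , q₂)

  IsBranchingBisim⇒SemiTransfer : ∀ {B} → IsBranchingBisim G B → SemiTransfer B
  IsBranchingBisim⇒SemiTransfer ib b st with transfer ib b st
  ... | inj₁ (refl , b′)                = idle ε b b′
  ... | inj₂ (_ , _ , path , st′ , b′) = move (TauPath⇒τ* path) st′ (TauPath-last b path) b′

  SemiTransfer-; : ∀ {A B} → SemiTransfer A → SemiTransfer B → SemiTransfer (A ; B)
  SemiTransfer-; trA trB (_ , a , b) st with trA a st
  ... | idle p a₁ a₂ =
    let _ , q , b₁ = SemiTransfer-⇒τ* trB b p in idle q (_ , a₁ , b₁) (_ , a₂ , b₁)
  ... | move p st′ a₁ a₂ with SemiTransfer-⇒τ* trB b p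
  ...   | _ , q , b₀ with trB b₀ st′
  ...     | idle q′ b₁ b₂      = idle (q ◅◅ q′) (_ , a₁ , b₁) (_ , a₂ , b₂)
  ...     | move q′ st″ b₁ b₂ = move (q ◅◅ q′) st″ (_ , a₁ , b₁) (_ , a₂ , b₂)

  SemiTransfer-∪ : ∀ {A B} → SemiTransfer A → SemiTransfer B → SemiTransfer (A ∪ B)
  SemiTransfer-∪ trA trB (inj₁ a) st = Answer-map inj₁ (trA a st)
  SemiTransfer-∪ trA trB (inj₂ b) st = Answer-map inj₂ (trB b st)

  ∼-refl : ∀ {s} → _∼_ G s s
  ∼-refl = _≡_ , isBisim , refl
    where
    isBisim : IsBranchingBisim G _≡_
    isBisim .symmetric = sym
    isBisim .transfer refl st = inj₂ (_ , _ , here , st , refl)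

  ∼-sym : ∀ {s t} → _∼_ G s t → _∼_ G t s
  ∼-sym (B , ib , b) = B , ib , symmetric ib b

  ∼-trans : ∀ {s t u} → _∼_ G s t → _∼_ G t u → _∼_ G s u
  ∼-trans (B₁ , ib₁ , b₁) (B₂ , ib₂ , b₂) =
    Stutter R , Stutter-isBranchingBisim R-sym R-tr , base (inj₁ (_ , b₁ , b₂))
    where
    R : Rel G
    R = (B₁ ; B₂) ∪ (B₂ ; B₁)

    R-sym : ∀ {u v} → R u v → R v u
    R-sym (inj₁ (t , x , y)) = inj₂ (t , symmetric ib₂ y , symmetric ib₁ x)
    R-sym (inj₂ (t , x , y)) = inj₁ (t , symmetric ib₁ y , symmetric ib₂ x)

    R-tr : SemiTransfer R
    R-tr = SemiTransfer-∪ (SemiTransfer-; tr₁ tr₂) (SemiTransfer-; tr₂ tr₁)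
      where
      tr₁ : SemiTransfer B₁
      tr₁ = IsBranchingBisim⇒SemiTransfer ib₁
      tr₂ : SemiTransfer B₂
      tr₂ = IsBranchingBisim⇒SemiTransfer ib₂

  ∼-stutter : ∀ {x u y v} → x ⇒τ* u → u ⇒τ* y → _∼_ G x v → _∼_ G y v → _∼_ G u v
  ∼-stutter x⇒u u⇒y (B₁ , ib₁ , b₁) (B₂ , ib₂ , b₂) =
    Stutter (B₁ ∪ B₂) ,
    Stutter-isBranchingBisim (⊎.map (symmetric ib₁) (symmetric ib₂))
      (SemiTransfer-∪ (IsBranchingBisim⇒SemiTransfer ib₁) (IsBranchingBisim⇒SemiTransfer ib₂)) ,
    between x⇒u u⇒y (base (inj₁ b₁)) (base (inj₂ b₂))

  data Prefixed (B : Rel G) : Rel G where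
    prefix : ∀ δ {s t} → B s t → Prefixed B (δ ++ s) (δ ++ t)

  Prefixed-isBranchingBisim : ∀ {B} → IsBranchingBisim G B → IsBranchingBisim G (Prefixed B)
  Prefixed-isBranchingBisim ib .symmetric (prefix δ b) = prefix δ (symmetric ib b)
  Prefixed-isBranchingBisim ib .transfer (prefix [] b) st with transfer ib b st
  ... | inj₁ (eq , b′) = inj₁ (eq , prefix [] b′)
  ... | inj₂ (tk , t′ , path , st′ , b′) =
    inj₂ (tk , t′ , TauPath-map (prefix []) path , st′ , prefix [] b′)
  Prefixed-isBranchingBisim {B} ib .transfer (prefix (A ∷ δ) {s} {t} b) (step {α = α} _ r) =
    inj₂ (_ , _ , here , step (δ ++ t) r ,
          subst₂ (Prefixed B) (++-assoc α δ s) (++-assoc α δ t) (prefix (α ++ δ) b))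

  ∼-congˡ : ∀ δ {s t} → _∼_ G s t → _∼_ G (δ ++ s) (δ ++ t)
  ∼-congˡ δ (B , ib , b) = Prefixed B , Prefixed-isBranchingBisim ib , prefix δ b

module RedundantPrefixes (G : BPA) where
  open BranchingBisimilarity G
  open IsBranchingBisim

  Step-++ʳ : ∀ γ {s a s′} → Step G s a s′ → Step G (s ++ γ) a (s′ ++ γ)
  Step-++ʳ γ (step {α = α} β r) =
    subst (Step G _ _) (sym (++-assoc α β γ)) (step (β ++ γ) r)

  Steps-++ʳ : ∀ γ {s w s′} → Steps G s w s′ → Steps G (s ++ γ) w (s′ ++ γ)
  Steps-++ʳ γ refl     = refl
  Steps-++ʳ γ (st ◅ p) = Step-++ʳ γ st ◅ Steps-++ʳ γ p

  ⇒τ*-++ʳ : ∀ γ {s s′} → s ⇒τ* s′ → (s ++ γ) ⇒τ* (s′ ++ γ)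
  ⇒τ*-++ʳ γ = gmap (_++ γ) (Step-++ʳ γ)

  Steps-trans : ∀ {s u t w v} → Steps G s u t → Steps G t w v → Steps G s (u ++ w) v
  Steps-trans refl     q = q
  Steps-trans (st ◅ p) q = st ◅ Steps-trans p q

  Steps-++⁻ : ∀ α {β w} → Steps G (α ++ β) w [] →
              ∃₂ λ w₁ w₂ → w ≡ w₁ ++ w₂ × Steps G α w₁ [] × Steps G β w₂ []
  Steps-++⁻ [] p = [] , _ , refl , refl , p
  Steps-++⁻ (A ∷ α) {β} (step {a = a} {α = γ} _ r ◅ p)
    with Steps-++⁻ (γ ++ α) (subst (λ s → Steps G s _ []) (sym (++-assoc γ α β)) p)
  ... | w₁ , w₂ , refl , p₁ , p₂ = a ∷ w₁ , w₂ , refl , step α r ◅ p₁ , p₂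

  Normed⇒Steps-[] : Normed G → ∀ β → ∃ λ w → Steps G β w []
  Normed⇒Steps-[] normed []      = [] , refl
  Normed⇒Steps-[] normed (Y ∷ β) =
    let w , p = normed Y
        w′ , p′ = Normed⇒Steps-[] normed β
    in w ++ w′ , Steps-trans (Steps-++ʳ β p) p′

  weight : Act G → ℕ
  weight τ       = 0
  weight (vis _) = 1

  visible : List (Act G) → ℕ
  visible w = sum (map weight w)

  visible-++ : ∀ u w → visible (u ++ w) ≡ visible u + visible w
  visible-++ u w = trans (cong sum (map-++ weight u w)) (sum-++ (map weight u) (map weight w))

  invisible⇒τ* : ∀ {s w t} → Steps G s w t → visible w ≡ 0 → s ⇒τ* t
  invisible⇒τ* refl                   _ = ε
  invisible⇒τ* (_◅_ {a = τ} st p)     e = st ◅ invisible⇒τ* p e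
  invisible⇒τ* (_◅_ {a = vis _} st p) ()

  τ*⇒invisible : ∀ {s t} → s ⇒τ* t → ∃ λ w → Steps G s w t × visible w ≡ 0
  τ*⇒invisible ε        = [] , refl , refl
  τ*⇒invisible (st ◅ p) = let w , q , e = τ*⇒invisible p in τ ∷ w , st ◅ q , e

  invisible-++⁻ : ∀ α {β w} → Steps G (α ++ β) w [] → visible w ≡ 0 →
                  α ⇒τ* [] × β ⇒τ* []
  invisible-++⁻ α p w-vis with Steps-++⁻ α p
  ... | w₁ , w₂ , refl , p₁ , p₂ =
    invisible⇒τ* p₁ (m+n≡0⇒m≡0 _ parts) , invisible⇒τ* p₂ (m+n≡0⇒n≡0 (visible w₁) parts)
    where
    parts : visible w₁ + visible w₂ ≡ 0
    parts = trans (sym (visible-++ w₁ w₂)) w-vis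

  simulate : ∀ {B s t v s′} → IsBranchingBisim G B → B s t → Steps G s v s′ →
             ∃₂ λ v′ t′ → Steps G t v′ t′ × B s′ t′ × visible v′ ≡ visible v
  simulate ib b refl = [] , _ , refl , b , refl
  simulate ib b (_◅_ {a = a} st p) with transfer ib b st
  ... | inj₁ (refl , b′) = simulate ib b′ p
  ... | inj₂ (_ , _ , path , st′ , b′) =
    let u , q₁ , u-vis = τ*⇒invisible (TauPath⇒τ* path)
        v′ , t′ , q , b″ , v′-vis = simulate ib b′ p
    in u ++ a ∷ v′ , t′ , Steps-trans q₁ (st′ ◅ q) , b″ ,
       trans (visible-++ u (a ∷ v′)) (cong₂ (λ m n → m + (weight a + n)) u-vis v′-vis)

  []-related⇒τ-only : ∀ {B z w z′} → IsBranchingBisim G B → B [] z → Steps G z w z′ →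
                     All (_≡ τ) w
  []-related⇒τ-only ib b refl = []
  []-related⇒τ-only ib b (st ◅ p) with transfer ib (symmetric ib b) st
  ... | inj₁ (eq , b′) = eq ∷ []-related⇒τ-only ib (symmetric ib b′) p
  ... | inj₂ (_ , _ , here , () , _)
  ... | inj₂ (_ , _ , there () _ _ , _ , _)

  []-related⇒[] : NoSilentVars G → ∀ {B t} → IsBranchingBisim G B → B [] t → t ≡ []
  []-related⇒[] noSilent {t = []}    ib b = refl
  []-related⇒[] noSilent {t = Y ∷ t} ib b =
    ⊥-elim (noSilent Y (λ w α p → []-related⇒τ-only ib b (Steps-++ʳ t p)))

  redundant⇒τ-emptiable-acc : NoSilentVars G → ∀ {B α β v} → IsBranchingBisim G B →
    B (α ++ β) β → Steps G β v [] → Acc _<_ (visible v) →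
    ∃ λ w → Steps G α w [] × visible w ≡ 0
  redundant⇒τ-emptiable-acc noSilent {α = α} {v = v} ib b p (acc rs)
    with simulate ib (symmetric ib b) p
  ... | v′ , _ , p′ , b′ , v′-vis with []-related⇒[] noSilent ib b′
  ... | refl with Steps-++⁻ α p′
  ... | w₁ , w₂ , refl , p₁ , p₂ with visible w₁ in w₁-vis
  ... | zero  = w₁ , p₁ , w₁-vis
  ... | suc k = redundant⇒τ-emptiable-acc noSilent ib b p₂ (rs w₂-shorter)
    where
    w₂-shorter : visible w₂ < visible v
    w₂-shorter = subst (visible w₂ <_)
      (trans (cong (_+ visible w₂) (sym w₁-vis)) (trans (sym (visible-++ w₁ w₂)) v′-vis))
      (m<n+m (visible w₂) (s≤s z≤n))

  redundant⇒τ-emptiable : Normed G → NoSilentVars G → ∀ α {β} → _∼_ G (α ++ β) β →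
                          ∃ λ w → Steps G α w [] × visible w ≡ 0
  redundant⇒τ-emptiable normed noSilent α {β} (B , ib , b) =
    let v , p = Normed⇒Steps-[] normed β
    in redundant⇒τ-emptiable-acc noSilent ib b p (<-wellFounded (visible v))

  ∼⇒All-Red : Normed G → NoSilentVars G → ∀ α β → _∼_ G (α ++ β) β → All (Red G β) α
  ∼⇒All-Red normed noSilent []      β _     = []
  ∼⇒All-Red normed noSilent (X ∷ α) β Xαβ∼β =
    ∼-trans (∼-congˡ (X ∷ []) (∼-sym αβ∼β)) Xαβ∼β ∷ ∼⇒All-Red normed noSilent α β αβ∼β
    where
    αβ∼β : _∼_ G (α ++ β) β
    αβ∼β =
      let _ , p , p-vis = redundant⇒τ-emptiable normed noSilent (X ∷ α) Xαβ∼β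
          X⇒[] , α⇒[] = invisible-++⁻ (X ∷ []) p p-vis
      in ∼-stutter (⇒τ*-++ʳ (α ++ β) X⇒[]) (⇒τ*-++ʳ β α⇒[]) Xαβ∼β ∼-refl

  All-Red⇒∼ : ∀ α β → All (Red G β) α → _∼_ G (α ++ β) β
  All-Red⇒∼ []      β []            = ∼-refl
  All-Red⇒∼ (X ∷ α) β (Xβ∼β ∷ reds) = ∼-trans (∼-congˡ (X ∷ []) (All-Red⇒∼ α β reds)) Xβ∼β

proposition4 : (G : BPA) → Normed G → NoSilentVars G →
    (α β : State G) → (_∼_ G (α ++ β) β) ⇔ All (Red G β) α
proposition4 G normed noSilent α β = mk⇔ (∼⇒All-Red normed noSilent α β) (All-Red⇒∼ α β)
  where open RedundantPrefixes G
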